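{- For all positive integers $p,q$, the length generating polynomials satisfy $$E_{p,q}(t)=E_{p-1,q}(t)+E_{p,q-1}(t)+\big([p+q]_t-1\big)E_{p-1,q-1}(t),$$ where $[m]_t=\frac{t^m-1}{t-1}=1+t+\cdots+t^{m-1}$.
   Context: A signed $(p,q)$-involution ($p,q\ge0$, $n=p+q$) is an involution $\pi$ of $\{1,\dots,n\}$ together with a sign $+$ or $-$ on each fixed point such that (number of $+$) $-$ (number of $-$) $=p-q$; $I^{\pm}_{p,q}$ denotes the set of them. For such $\pi$ with exactly $k$ 2-cycles, let $\ell(\pi)$ be the number of inversions of the underlying permutation $\pi\in S_n$ (pairs $i<j$ with $\pi(i)>\pi(j)$), and define the length $\mathbb{L}(\pi)=\frac{\ell(\pi)+k}{2}$. The length generating function is $E_{p,q}(t)=\sum_{\pi\in I^{\pm}_{p,q}}t^{\mathbb{L}(\pi)}$. -}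

module Defs where

open import Data.Nat using (ℕ; zero; suc; _+_; _*_; _∸_; _<ᵇ_; _≡ᵇ_; _/_)
open import Data.Bool using (Bool; true; false; if_then_else_; _∧_; not)
open import Data.Bool.Properties using () renaming (_≟_ to _≟B_)
open import Data.Fin using (Fin; toℕ)
open import Data.Fin.Properties using () renaming (_≟_ to _≟F_)
open import Data.Sum using (_⊎_; inj₁; inj₂)
open import Data.Vec using (Vec; []; _∷_; lookup)
open import Data.List using (List; []; _∷_; _++_; map; concatMap; length; allFin; upTo)
open import Data.Nat.ListAction using (sum)
open import Relation.Nullary using (does)
open import Relation.Binary.PropositionalEquality using (_≡_)

filterᵇ : ∀ {A : Set} → (A → Bool) → List A → List A
filterᵇ f [] = []
filterᵇ f (x ∷ xs) = if f x then x ∷ filterᵇ f xs else filterᵇ f xs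

allᵇ : ∀ {A : Set} → (A → Bool) → List A → Bool
allᵇ f [] = true
allᵇ f (x ∷ xs) = f x ∧ allᵇ f xs

-- A labelling of {0..n-1}: position i carries either its partner j (2-cycle (i j))
-- or a sign (true = +, false = -) when i is a fixed point.
Label : ℕ → Set
Label n = Fin n ⊎ Bool

allLabels : (n : ℕ) → List (Label n)
allLabels n = map inj₁ (allFin n) ++ (inj₂ true ∷ inj₂ false ∷ [])

allVecs : ∀ {A : Set} → List A → (m : ℕ) → List (Vec A m)
allVecs xs zero = [] ∷ []
allVecs xs (suc m) = concatMap (λ x → map (x ∷_) (allVecs xs m)) xs

isLabel : ∀ {n} → Label n → Fin n → Bool
isLabel (inj₁ j) i = does (j ≟F i)
isLabel (inj₂ _) i = false

wellFormed : ∀ {n} → Vec (Label n) n → Bool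
wellFormed {n} v = allᵇ ok (allFin n)
  where
  ok : Fin n → Bool
  ok i with lookup v i
  ... | inj₁ j = not (does (j ≟F i)) ∧ isLabel (lookup v j) i
  ... | inj₂ _ = true

isSign : ∀ {n} → Bool → Label n → Bool
isSign b (inj₁ _) = false
isSign b (inj₂ c) = does (c ≟B b)

countSign : ∀ {n} → Bool → Vec (Label n) n → ℕ
countSign {n} b v = length (filterᵇ (λ i → isSign b (lookup v i)) (allFin n))

-- (#plus) - (#minus) = p - q, i.e. #plus + q = #minus + p
isSignedInv : (p q : ℕ) → Vec (Label (p + q)) (p + q) → Bool
isSignedInv p q v = wellFormed v ∧ ((countSign true v + q) ≡ᵇ (countSign false v + p))

SignedInvs : (p q : ℕ) → List (Vec (Label (p + q)) (p + q))
SignedInvs p q = filterᵇ (isSignedInv p q) (allVecs (allLabels (p + q)) (p + q))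

perm : ∀ {n} → Vec (Label n) n → Fin n → Fin n
perm v i with lookup v i
... | inj₁ j = j
... | inj₂ _ = i

inversions : ∀ {n} → Vec (Label n) n → ℕ
inversions {n} v =
  sum (map (λ i → sum (map (λ j →
    if (toℕ i <ᵇ toℕ j) ∧ (toℕ (perm v j) <ᵇ toℕ (perm v i)) then 1 else 0)
    (allFin n))) (allFin n))

twoCycles : ∀ {n} → Vec (Label n) n → ℕ
twoCycles {n} v = length (filterᵇ (λ i → isPartner (lookup v i)) (allFin n)) / 2
  where
  isPartner : Label n → Bool
  isPartner (inj₁ _) = true
  isPartner (inj₂ _) = false

len : ∀ {n} → Vec (Label n) n → ℕ
len v = (inversions v + twoCycles v) / 2

-- Polynomials with ℕ coefficients, as coefficient functions (finite support).
Poly : Set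
Poly = ℕ → ℕ

_⊕_ : Poly → Poly → Poly
(f ⊕ g) k = f k + g k
infixl 6 _⊕_

_⊖_ : Poly → Poly → Poly
(f ⊖ g) k = f k ∸ g k
infixl 6 _⊖_

_⊛_ : Poly → Poly → Poly
(f ⊛ g) k = sum (map (λ i → f i * g (k ∸ i)) (upTo (suc k)))
infixl 7 _⊛_

onePoly : Poly
onePoly zero = 1
onePoly (suc _) = 0

qint : ℕ → Poly
qint m i = if i <ᵇ m then 1 else 0

E : ℕ → ℕ → Poly
E p q m = length (filterᵇ (λ v → len v ≡ᵇ m) (SignedInvs p q))

-- Proof idea: classify a signed involution on {0, …, n+1} by what happens at 0.
--   * 0 is a fixed point with sign + or −: deleting it leaves a signed
--     involution on n+1 points with one sign fewer and the same length.
--   * 0 is paired with j+1 (0 ≤ j ≤ n): deleting the 2-cycle (0, j+1) leaves a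
--     signed involution on n points with the same signs, and the length drops
--     by exactly j+1 (the cycle accounts for 2j+1 inversions and one 2-cycle).
--   * 0 cannot be paired with itself.
-- The cycles contribute ∑_{j ≤ n} t^{j+1} E_{p,q} = ([n+2]_t − 1) E_{p,q}.
module Submission where

open import Defs
import Algebra.Properties.CommutativeMonoid.Sum as MonoidSum
open import Data.Bool using (Bool; true; false; if_then_else_; _∧_; not)
open import Data.Bool.Properties using (∧-commutativeMonoid; ∧-zeroʳ; ∧-identityʳ)
open import Data.Fin using (Fin; zero; suc; toℕ; punchIn)
open import Data.Fin.Permutation using (permutation)
open import Data.Fin.Properties using (suc-injective; punchIn-injective; punchInᵢ≢i; toℕ≤pred[n])
  renaming (_≟_ to _≟F_)
open import Data.List using (List; []; _∷_; _++_; map; concatMap; length; allFin; tabulate; applyUpTo)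
open import Data.List.Properties using (map-++; map-cong; map-∘)
open import Data.Nat using (ℕ; zero; suc; _+_; _*_; _∸_; _<ᵇ_; _≡ᵇ_; _/_; _≤_; z≤n; s≤s)
open import Data.Nat.DivMod using (m/n≡1+[m∸n]/n; m*n/n≡m; +-distrib-/-∣ʳ)
open import Data.Nat.Divisibility using (n∣m*n)
open import Data.Nat.ListAction using (sum)
open import Data.Nat.Tactic.RingSolver using (solve-∀)
open import Data.Nat.ListAction.Properties using (sum-++)
open import Data.Nat.Properties
  using (+-comm; +-suc; +-identityʳ; *-zeroʳ; *-distribˡ-+; +-0-commutativeMonoid;
         +-commutativeSemigroup)
open import Algebra.Properties.CommutativeSemigroup +-commutativeSemigroup
  using () renaming (interchange to +-interchange)
open import Data.Sum using (_⊎_; inj₁; inj₂)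
open import Data.Vec using (Vec; _∷_; lookup; insertAt) renaming (map to mapᵥ)
open import Data.Vec.Properties using (lookup-map; insertAt-lookup; insertAt-punchIn)
open import Function using (_∘_)
open import Relation.Nullary using (does; yes; no)
open import Relation.Nullary.Decidable using (dec-true; dec-false)
open import Relation.Binary.PropositionalEquality

private variable
  A B : Set
  k n : ℕ

𝟙 : Bool → ℕ
𝟙 b = if b then 1 else 0

module ∑-Props = MonoidSum +-0-commutativeMonoid
module ⋀-Props = MonoidSum ∧-commutativeMonoid

open ∑-Props using (∑-distrib-+) renaming (sum to ∑; sum-remove to ∑-remove; sum-cong-≗ to ∑-cong)
open ⋀-Props using () renaming (sum to ⋀; sum-remove to ⋀-remove; sum-cong-≗ to ⋀-cong)

∑-zero : {f : Fin n → ℕ} → (∀ i → f i ≡ 0) → ∑ f ≡ 0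
∑-zero {n} f≡0 = trans (∑-cong f≡0) (∑-Props.sum-replicate-zero n)

∑-involution : (σ : Fin n → Fin n) → (∀ i → σ (σ i) ≡ i) → (f : Fin n → ℕ) → ∑ (f ∘ σ) ≡ ∑ f
∑-involution σ σσ f = sym (∑-Props.sum-permute f (permutation σ σ σσ σσ))

⋀-false : (f : Fin n → Bool) (i : Fin n) → f i ≡ false → ⋀ f ≡ false
⋀-false {suc n} f i fi≡false =
  trans (⋀-remove {i = i} f) (cong (_∧ ⋀ (f ∘ punchIn i)) fi≡false)

⋀-true : (f : Fin n → Bool) → ⋀ f ≡ true → ∀ i → f i ≡ true
⋀-true {suc n} f ⋀f≡true i with f i in fi
... | true  = refl
... | false = trans (sym (⋀-false f i fi)) ⋀f≡true

∑-below : ∀ k t → t ≤ k → ∑ {k} (λ i → 𝟙 (toℕ i <ᵇ t)) ≡ t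
∑-below zero    zero    z≤n       = refl
∑-below (suc k) zero    z≤n       = ∑-zero {suc k} (λ _ → refl)
∑-below (suc k) (suc t) (s≤s t≤k) = cong suc (∑-below k t t≤k)

-- ∑_{i<m} [i<M] g i = ∑_{i<M} [i<m] g i: both are the sum over i < min m M.
∑-truncate-swap : ∀ M m (g : ℕ → ℕ) →
  ∑ {m} (λ i → 𝟙 (toℕ i <ᵇ M) * g (toℕ i)) ≡ ∑ {M} (λ i → 𝟙 (toℕ i <ᵇ m) * g (toℕ i))
∑-truncate-swap zero    m       g = ∑-zero {m} (λ _ → refl)
∑-truncate-swap (suc M) zero    g = sym (∑-zero {suc M} (λ _ → refl))
∑-truncate-swap (suc M) (suc m) g = cong (1 * g 0 +_) (∑-truncate-swap M m (g ∘ suc))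

count : (A → ℕ) → List A → ℕ
count f xs = sum (map f xs)

count-cong : {f g : A → ℕ} → (∀ x → f x ≡ g x) → (xs : List A) → count f xs ≡ count g xs
count-cong f≗g xs = cong sum (map-cong f≗g xs)

count-zero : {f : A → ℕ} → (∀ x → f x ≡ 0) → (xs : List A) → count f xs ≡ 0
count-zero f≡0 []       = refl
count-zero f≡0 (x ∷ xs) = cong₂ _+_ (f≡0 x) (count-zero f≡0 xs)

count-++ : (f : A → ℕ) (xs ys : List A) → count f (xs ++ ys) ≡ count f xs + count f ys
count-++ f xs ys = trans (cong sum (map-++ f xs ys)) (sum-++ (map f xs) (map f ys))

count-map : (f : B → ℕ) (g : A → B) (xs : List A) → count f (map g xs) ≡ count (f ∘ g) xs
count-map f g xs = cong sum (sym (map-∘ xs))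

count-scale : (c : ℕ) (f : A → ℕ) (xs : List A) → count (λ x → c * f x) xs ≡ c * count f xs
count-scale c f []       = sym (*-zeroʳ c)
count-scale c f (x ∷ xs) =
  trans (cong (c * f x +_) (count-scale c f xs)) (sym (*-distribˡ-+ c (f x) _))

count-+ : (f g : A → ℕ) (xs : List A) → count (λ x → f x + g x) xs ≡ count f xs + count g xs
count-+ f g []       = refl
count-+ f g (x ∷ xs) =
  trans (cong (f x + g x +_) (count-+ f g xs)) (+-interchange (f x) (g x) (count f xs) (count g xs))

count-concatMap : (f : B → ℕ) (g : A → List B) (xs : List A) →
  count f (concatMap g xs) ≡ count (λ x → count f (g x)) xs
count-concatMap f g []       = refl
count-concatMap f g (x ∷ xs) =
  trans (count-++ f (g x) (concatMap g xs)) (cong (count f (g x) +_) (count-concatMap f g xs))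

count-comm : (f : A → B → ℕ) (xs : List A) (ys : List B) →
  count (λ x → count (f x) ys) xs ≡ count (λ y → count (λ x → f x y) xs) ys
count-comm f []       ys = sym (count-zero (λ _ → refl) ys)
count-comm f (x ∷ xs) ys =
  trans (cong (count (f x) ys +_) (count-comm f xs ys))
        (sym (count-+ (f x) (λ y → count (λ x → f x y) xs) ys))

count-tabulate : (f : A → ℕ) (h : Fin n → A) → count f (tabulate h) ≡ ∑ (f ∘ h)
count-tabulate {n = zero}  f h = refl
count-tabulate {n = suc n} f h = cong (f (h zero) +_) (count-tabulate f (h ∘ suc))

count-applyUpTo : (f : ℕ → ℕ) (g : ℕ → ℕ) (n : ℕ) → count f (applyUpTo g n) ≡ ∑ {n} (λ i → f (g (toℕ i)))
count-applyUpTo f g zero    = refl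
count-applyUpTo f g (suc n) = cong (f (g 0) +_) (count-applyUpTo f (g ∘ suc) n)

length-filter : (P : A → Bool) (xs : List A) → length (filterᵇ P xs) ≡ count (𝟙 ∘ P) xs
length-filter P []       = refl
length-filter P (x ∷ xs) with P x
... | true  = cong suc (length-filter P xs)
... | false = length-filter P xs

∑Vec : List A → (n : ℕ) → (Vec A n → ℕ) → ℕ
∑Vec L n f = count f (allVecs L n)

∑Vec-cong : (L : List A) (n : ℕ) {f g : Vec A n → ℕ} → (∀ w → f w ≡ g w) → ∑Vec L n f ≡ ∑Vec L n g
∑Vec-cong L n f≗g = count-cong f≗g (allVecs L n)

∑Vec-zero : (L : List A) (n : ℕ) {f : Vec A n → ℕ} → (∀ w → f w ≡ 0) → ∑Vec L n f ≡ 0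
∑Vec-zero L n f≡0 = count-zero f≡0 (allVecs L n)

∑Vec-head : (L : List A) (n : ℕ) (f : Vec A (suc n) → ℕ) →
  ∑Vec L (suc n) f ≡ count (λ x → ∑Vec L n (f ∘ (x ∷_))) L
∑Vec-head L n f =
  trans (count-concatMap f (λ x → map (x ∷_) (allVecs L n)) L)
        (count-cong (λ x → count-map f (x ∷_) (allVecs L n)) L)

∑Vec-insertAt : (L : List A) (n : ℕ) (j : Fin (suc n)) (f : Vec A (suc n) → ℕ) →
  ∑Vec L (suc n) f ≡ count (λ x → ∑Vec L n (λ w → f (insertAt w j x))) L
∑Vec-insertAt L n       zero    f = ∑Vec-head L n f
∑Vec-insertAt L (suc n) (suc j) f = begin
  ∑Vec L (suc (suc n)) f
    ≡⟨ ∑Vec-head L (suc n) f ⟩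
  count (λ y → ∑Vec L (suc n) (λ w → f (y ∷ w))) L
    ≡⟨ count-cong (λ y → ∑Vec-insertAt L n j (λ w → f (y ∷ w))) L ⟩
  count (λ y → count (λ x → ∑Vec L n (λ w → f (y ∷ insertAt w j x))) L) L
    ≡⟨ count-comm (λ y x → ∑Vec L n (λ w → f (y ∷ insertAt w j x))) L L ⟩
  count (λ x → count (λ y → ∑Vec L n (λ w → f (y ∷ insertAt w j x))) L) L
    ≡⟨ count-cong (λ x → sym (∑Vec-head L n (λ w → f (insertAt w (suc j) x)))) L ⟩
  count (λ x → ∑Vec L (suc n) (λ w → f (insertAt w (suc j) x))) L ∎
  where open ≡-Reasoning

∑Vec-relabel : (Bad : A → Set) (h : B → A) (L : List A) (L′ : List B) →
  (∀ (g : A → ℕ) → (∀ x → Bad x → g x ≡ 0) → count g L ≡ count (g ∘ h) L′) →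
  ∀ n (f : Vec A n → ℕ) → (∀ w i → Bad (lookup w i) → f w ≡ 0) →
  ∑Vec L n f ≡ ∑Vec L′ n (f ∘ mapᵥ h)
∑Vec-relabel Bad h L L′ relabel zero    f f-bad = refl
∑Vec-relabel Bad h L L′ relabel (suc n) f f-bad = begin
  ∑Vec L (suc n) f
    ≡⟨ ∑Vec-head L n f ⟩
  count (λ x → ∑Vec L n (f ∘ (x ∷_))) L
    ≡⟨ count-cong (λ x → ∑Vec-relabel Bad h L L′ relabel n (f ∘ (x ∷_))
                           (λ w i → f-bad (x ∷ w) (suc i))) L ⟩
  count (λ x → ∑Vec L′ n (λ w → f (x ∷ mapᵥ h w))) L
    ≡⟨ relabel (λ x → ∑Vec L′ n (λ w → f (x ∷ mapᵥ h w)))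
               (λ x bad → ∑Vec-zero L′ n (λ w → f-bad (x ∷ mapᵥ h w) zero bad)) ⟩
  count (λ y → ∑Vec L′ n (λ w → f (h y ∷ mapᵥ h w))) L′
    ≡⟨ sym (∑Vec-head L′ n (f ∘ mapᵥ h)) ⟩
  ∑Vec L′ (suc n) (f ∘ mapᵥ h) ∎
  where open ≡-Reasoning

isPair : Label n → Bool
isPair (inj₁ _) = true
isPair (inj₂ _) = false

partnerOf : Fin n → Label n → Fin n
partnerOf i (inj₁ j) = j
partnerOf i (inj₂ _) = i

π : Vec (Label n) n → Fin n → Fin n
π v i = partnerOf i (lookup v i)

consistentAt : Vec (Label n) n → Fin n → Label n → Bool
consistentAt v i (inj₁ j) = not (does (j ≟F i)) ∧ isLabel (lookup v j) i
consistentAt v i (inj₂ _) = true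

consistent : Vec (Label n) n → Fin n → Bool
consistent v i = consistentAt v i (lookup v i)

signCount : Bool → Vec (Label n) n → ℕ
signCount c v = ∑ (λ i → 𝟙 (isSign c (lookup v i)))

pairCount : Vec (Label n) n → ℕ
pairCount v = ∑ (λ i → 𝟙 (isPair (lookup v i)))

invCount : (Fin n → Fin n) → ℕ
invCount σ = ∑ (λ a → ∑ (λ b → 𝟙 ((toℕ a <ᵇ toℕ b) ∧ (toℕ (σ b) <ᵇ toℕ (σ a)))))

-- Defs builds wellFormed and twoCycles from where-bound predicates, which
-- cannot be named; these two functions read such a predicate off the
-- definitional unfolding of the statistic, so that it can be reasoned about.
predicateOfAll : {f : Fin n → Bool} {xs : List (Fin n)} {b : Bool} →
  allᵇ f xs ≡ b → Fin n → Bool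
predicateOfAll {f = f} _ = f

predicateOfHalfCount : {f : Fin n → Bool} {xs : List (Fin n)} {b : ℕ} →
  length (filterᵇ f xs) / 2 ≡ b → Fin n → Bool
predicateOfHalfCount {f = f} _ = f

allᵇ-tabulate : (f : A → Bool) (h : Fin n → A) → allᵇ f (tabulate h) ≡ ⋀ (f ∘ h)
allᵇ-tabulate {n = zero}  f h = refl
allᵇ-tabulate {n = suc n} f h = cong (f (h zero) ∧_) (allᵇ-tabulate f (h ∘ suc))

allᵇ-cong : {f g : A → Bool} → (∀ x → f x ≡ g x) → (xs : List A) → allᵇ f xs ≡ allᵇ g xs
allᵇ-cong f≗g []       = refl
allᵇ-cong f≗g (x ∷ xs) = cong₂ _∧_ (f≗g x) (allᵇ-cong f≗g xs)

module _ (v : Vec (Label n) n) where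

  wellFormed-⋀ : wellFormed v ≡ ⋀ (consistent v)
  wellFormed-⋀ = trans (allᵇ-cong local≗consistent (allFin n)) (allᵇ-tabulate (consistent v) (λ i → i))
    where
    local≗consistent : ∀ i → predicateOfAll {xs = allFin n} (refl {x = wellFormed v}) i ≡ consistent v i
    local≗consistent i with lookup v i
    ... | inj₁ _ = refl
    ... | inj₂ _ = refl

  countSign-∑ : ∀ c → countSign c v ≡ signCount c v
  countSign-∑ c = trans (length-filter _ (allFin n)) (count-tabulate {n = n} _ (λ i → i))

  twoCycles-∑ : twoCycles v ≡ pairCount v / 2
  twoCycles-∑ = cong (_/ 2) (begin
    length (filterᵇ local (allFin n))    ≡⟨ length-filter local (allFin n) ⟩
    count (𝟙 ∘ local) (allFin n)          ≡⟨ count-cong (cong 𝟙 ∘ local≗isPair) (allFin n) ⟩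
    count (λ i → 𝟙 (isPair (lookup v i))) (allFin n) ≡⟨ count-tabulate {n = n} _ (λ i → i) ⟩
    pairCount v                            ∎)
    where
    open ≡-Reasoning
    local = predicateOfHalfCount {xs = allFin n} (refl {x = twoCycles v})
    local≗isPair : ∀ i → local i ≡ isPair (lookup v i)
    local≗isPair i with lookup v i
    ... | inj₁ _ = refl
    ... | inj₂ _ = refl

  inversions-∑ : inversions v ≡ invCount (π v)
  inversions-∑ = trans (count-tabulate {n = n} _ (λ i → i)) (∑-cong λ a →
    trans (count-tabulate {n = n} _ (λ i → i)) (∑-cong λ b →
      cong₂ (λ x y → 𝟙 ((toℕ a <ᵇ toℕ b) ∧ (toℕ x <ᵇ toℕ y))) (perm≡π b) (perm≡π a)))
    where
    perm≡π : ∀ i → perm v i ≡ π v i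
    perm≡π i with lookup v i
    ... | inj₁ _ = refl
    ... | inj₂ _ = refl

π-involution : (w : Vec (Label n) n) → wellFormed w ≡ true → ∀ i → π w (π w i) ≡ i
π-involution w wf i = involutive i (⋀-true (consistent w) (trans (sym (wellFormed-⋀ w)) wf) i)
  where
  ∧-true-right : ∀ {x y} → x ∧ y ≡ true → y ≡ true
  ∧-true-right {true} y≡true = y≡true

  backToI : ∀ i (x : Label _) → isLabel x i ≡ true → ∀ l → partnerOf l x ≡ i
  backToI i (inj₁ i′) x≡i l with i′ ≟F i
  ... | yes i′≡i = i′≡i
  backToI i (inj₁ i′) ()  l | no _
  backToI i (inj₂ _)  ()  l

  involutive : ∀ i → consistent w i ≡ true → π w (π w i) ≡ i
  involutive i ok with lookup w i in wi
  ... | inj₁ l = backToI i (lookup w l) (∧-true-right ok) l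
  ... | inj₂ _ = cong (partnerOf i) wi

-- v is a signed involution whose signs balance as (#+) − (#−) = a − b
isSigned : ℕ → ℕ → Vec (Label n) n → Bool
isSigned a b v = wellFormed v ∧ (countSign true v + b ≡ᵇ countSign false v + a)

counted : ℕ → ℕ → ℕ → Vec (Label n) n → ℕ
counted a b m v = 𝟙 (isSigned a b v ∧ (len v ≡ᵇ m))

signedCount : (n a b m : ℕ) → ℕ
signedCount n a b m = ∑Vec (allLabels n) n (counted a b m)

length-filter-filter : (P Q : A → Bool) (xs : List A) →
  length (filterᵇ P (filterᵇ Q xs)) ≡ count (λ x → 𝟙 (Q x ∧ P x)) xs
length-filter-filter P Q []       = refl
length-filter-filter P Q (x ∷ xs) with Q x
... | false = length-filter-filter P Q xs
... | true with P x
...   | true  = cong suc (length-filter-filter P Q xs)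
...   | false = length-filter-filter P Q xs

E-signedCount : ∀ p q m → E p q m ≡ signedCount (p + q) p q m
E-signedCount p q m = length-filter-filter (λ v → len v ≡ᵇ m) (isSigned p q) (allVecs (allLabels (p + q)) (p + q))

signedCount-shift : ∀ n a b m → signedCount n (suc a) (suc b) m ≡ signedCount n a b m
signedCount-shift n a b m = ∑Vec-cong (allLabels n) n λ v →
  cong (λ t → 𝟙 ((wellFormed v ∧ t) ∧ (len v ≡ᵇ m)))
       (cong₂ _≡ᵇ_ (+-suc (countSign true v) b) (+-suc (countSign false v) a))

counted-illFormed : ∀ a b m (v : Vec (Label n) n) → wellFormed v ≡ false → counted a b m v ≡ 0
counted-illFormed a b m v illFormed rewrite illFormed = refl

illFormed-at : (v : Vec (Label n) n) (i : Fin n) → consistent v i ≡ false → wellFormed v ≡ false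
illFormed-at v i inconsistent = trans (wellFormed-⋀ v) (⋀-false (consistent v) i inconsistent)

relabel : (Fin k → Fin n) → Label k → Label n
relabel ρ (inj₁ j) = inj₁ (ρ j)
relabel ρ (inj₂ s) = inj₂ s

Embeds : (Fin k → Fin n) → Vec (Label n) n → Vec (Label k) k → Set
Embeds ρ v w = ∀ i → lookup v (ρ i) ≡ relabel ρ (lookup w i)

does-injective : (ρ : Fin k → Fin n) → (∀ {a b} → ρ a ≡ ρ b → a ≡ b) →
  ∀ a b → does (ρ a ≟F ρ b) ≡ does (a ≟F b)
does-injective ρ ρ-inj a b with a ≟F b
... | yes refl = dec-true (ρ a ≟F ρ a) refl
... | no  a≢b  = dec-false (ρ a ≟F ρ b) (a≢b ∘ ρ-inj)

module Embedding (ρ : Fin k → Fin n) (ρ-inj : ∀ {a b} → ρ a ≡ ρ b → a ≡ b)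
                 (v : Vec (Label n) n) (w : Vec (Label k) k) (v⊇w : Embeds ρ v w) where

  isLabel-relabel : ∀ x i → isLabel (relabel ρ x) (ρ i) ≡ isLabel x i
  isLabel-relabel (inj₁ j) i = does-injective ρ ρ-inj j i
  isLabel-relabel (inj₂ _) i = refl

  consistent-embed : ∀ i → consistent v (ρ i) ≡ consistent w i
  consistent-embed i = trans (cong (consistentAt v (ρ i)) (v⊇w i)) (relabelled (lookup w i))
    where
    relabelled : ∀ x → consistentAt v (ρ i) (relabel ρ x) ≡ consistentAt w i x
    relabelled (inj₁ j) = cong₂ (λ eq lab → not eq ∧ lab) (does-injective ρ ρ-inj j i)
      (trans (cong (λ y → isLabel y (ρ i)) (v⊇w j)) (isLabel-relabel (lookup w j) i))
    relabelled (inj₂ _) = refl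

  sign-embed : ∀ c i → 𝟙 (isSign c (lookup v (ρ i))) ≡ 𝟙 (isSign c (lookup w i))
  sign-embed c i = trans (cong (𝟙 ∘ isSign c) (v⊇w i)) (relabelled (lookup w i))
    where
    relabelled : ∀ x → 𝟙 (isSign c (relabel ρ x)) ≡ 𝟙 (isSign c x)
    relabelled (inj₁ _) = refl
    relabelled (inj₂ _) = refl

  pair-embed : ∀ i → 𝟙 (isPair (lookup v (ρ i))) ≡ 𝟙 (isPair (lookup w i))
  pair-embed i = trans (cong (𝟙 ∘ isPair) (v⊇w i)) (relabelled (lookup w i))
    where
    relabelled : ∀ x → 𝟙 (isPair (relabel ρ x)) ≡ 𝟙 (isPair x)
    relabelled (inj₁ _) = refl
    relabelled (inj₂ _) = refl

  π-embed : ∀ i → π v (ρ i) ≡ ρ (π w i)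
  π-embed i = trans (cong (partnerOf (ρ i)) (v⊇w i)) (relabelled (lookup w i))
    where
    relabelled : ∀ x → partnerOf (ρ i) (relabel ρ x) ≡ ρ (partnerOf i x)
    relabelled (inj₁ _) = refl
    relabelled (inj₂ _) = refl

addFixed : Bool → Vec (Label n) n → Vec (Label (suc n)) (suc n)
addFixed s w = inj₂ s ∷ mapᵥ (relabel suc) w

module AddFixed (s : Bool) (w : Vec (Label n) n) where

  private
    v = addFixed s w
    open Embedding suc suc-injective v w (λ i → lookup-map i (relabel suc) w)

  wellFormed-addFixed : wellFormed v ≡ wellFormed w
  wellFormed-addFixed =
    trans (wellFormed-⋀ v) (trans (⋀-cong consistent-embed) (sym (wellFormed-⋀ w)))

  countSign-addFixed : ∀ c → countSign c v ≡ 𝟙 (isSign c (inj₂ {A = Fin n} s)) + countSign c w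
  countSign-addFixed c = trans (countSign-∑ v c)
    (cong (𝟙 (isSign c (inj₂ {A = Fin n} s)) +_) (trans (∑-cong (sign-embed c)) (sym (countSign-∑ w c))))

  -- The new point is a fixed point at the far left: it creates no inversion.
  invCount-addFixed : invCount (π v) ≡ invCount (π w)
  invCount-addFixed = cong₂ _+_ noInversionAt0 (∑-cong λ a → ∑-cong λ b →
    cong₂ (λ x y → 𝟙 ((toℕ a <ᵇ toℕ b) ∧ (toℕ x <ᵇ toℕ y))) (π-embed b) (π-embed a))
    where
    noInversionAt0 : ∑ (λ b → 𝟙 ((0 <ᵇ toℕ b) ∧ (toℕ (π v b) <ᵇ 0))) ≡ 0
    noInversionAt0 = ∑-zero {suc n} (λ b → cong 𝟙 (∧-zeroʳ (0 <ᵇ toℕ b)))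

  len-addFixed : len v ≡ len w
  len-addFixed = cong₂ (λ i t → (i + t) / 2)
    (trans (inversions-∑ v) (trans invCount-addFixed (sym (inversions-∑ w))))
    (trans (twoCycles-∑ v) (trans (cong (_/ 2) (∑-cong pair-embed)) (sym (twoCycles-∑ w))))

counted-addFixed-+ : ∀ a b m (w : Vec (Label n) n) → counted a b m (addFixed true w) ≡ counted a (suc b) m w
counted-addFixed-+ a b m w = cong₂ (λ x y → 𝟙 (x ∧ y))
  (cong₂ _∧_ wellFormed-addFixed
             (cong₂ _≡ᵇ_ (trans (cong (_+ b) (countSign-addFixed true)) (sym (+-suc _ b)))
                         (cong (_+ a) (countSign-addFixed false))))
  (cong (_≡ᵇ m) len-addFixed)
  where open AddFixed true w

counted-addFixed-− : ∀ a b m (w : Vec (Label n) n) → counted a b m (addFixed false w) ≡ counted (suc a) b m w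
counted-addFixed-− a b m w = cong₂ (λ x y → 𝟙 (x ∧ y))
  (cong₂ _∧_ wellFormed-addFixed
             (cong₂ _≡ᵇ_ (cong (_+ b) (countSign-addFixed true))
                         (trans (cong (_+ a) (countSign-addFixed false)) (sym (+-suc _ a)))))
  (cong (_≡ᵇ m) len-addFixed)
  where open AddFixed false w

punchIn-<ᵇ : (j : Fin (suc k)) (a b : Fin k) →
  (toℕ (punchIn j a) <ᵇ toℕ (punchIn j b)) ≡ (toℕ a <ᵇ toℕ b)
punchIn-<ᵇ zero    a       b       = refl
punchIn-<ᵇ (suc j) zero    zero    = refl
punchIn-<ᵇ (suc j) zero    (suc b) = refl
punchIn-<ᵇ (suc j) (suc a) zero    = refl
punchIn-<ᵇ (suc j) (suc a) (suc b) = punchIn-<ᵇ j a b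

punchIn-<ᵇ-self : (j : Fin (suc k)) (a : Fin k) → (toℕ (punchIn j a) <ᵇ toℕ j) ≡ (toℕ a <ᵇ toℕ j)
punchIn-<ᵇ-self zero    a       = refl
punchIn-<ᵇ-self (suc j) zero    = refl
punchIn-<ᵇ-self (suc j) (suc a) = punchIn-<ᵇ-self j a

cycleEmbedding : Fin (suc k) → Fin k → Fin (suc (suc k))
cycleEmbedding j = suc ∘ punchIn j

addCycle : Fin (suc k) → Vec (Label k) k → Vec (Label (suc (suc k))) (suc (suc k))
addCycle j w = inj₁ (suc j) ∷ insertAt (mapᵥ (relabel (cycleEmbedding j)) w) j (inj₁ zero)

module AddCycle (j : Fin (suc k)) (w : Vec (Label k) k) where

  private
    v = addCycle j w
    ρ = cycleEmbedding j
    σ = π w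
    τ = π v

    ρ-injective : ∀ {a b} → ρ a ≡ ρ b → a ≡ b
    ρ-injective = punchIn-injective j _ _ ∘ suc-injective

    v-at-j+1 : lookup v (suc j) ≡ inj₁ zero
    v-at-j+1 = insertAt-lookup (mapᵥ (relabel ρ) w) j (inj₁ zero)

    v⊇w : Embeds ρ v w
    v⊇w i = trans (insertAt-punchIn (mapᵥ (relabel ρ) w) j (inj₁ zero) i) (lookup-map i (relabel ρ) w)

    open Embedding ρ ρ-injective v w v⊇w

  ∑-positions : (f : Fin (suc (suc k)) → ℕ) → ∑ f ≡ f zero + (f (suc j) + ∑ (f ∘ ρ))
  ∑-positions f = cong (f zero +_) (∑-remove {i = j} (f ∘ suc))

  wellFormed-addCycle : wellFormed v ≡ wellFormed w
  wellFormed-addCycle = begin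
    wellFormed v                                                   ≡⟨ wellFormed-⋀ v ⟩
    consistent v zero ∧ ⋀ (consistent v ∘ suc)
      ≡⟨ cong (consistent v zero ∧_) (⋀-remove {i = j} (consistent v ∘ suc)) ⟩
    consistent v zero ∧ (consistent v (suc j) ∧ ⋀ (consistent v ∘ ρ))
      ≡⟨ cong₂ (λ x y → x ∧ (y ∧ ⋀ (consistent v ∘ ρ))) consistent-0 consistent-j+1 ⟩
    ⋀ (consistent v ∘ ρ)                                            ≡⟨ ⋀-cong consistent-embed ⟩
    ⋀ (consistent w)                                                ≡⟨ wellFormed-⋀ w ⟨
    wellFormed w                                                    ∎
    where
    open ≡-Reasoning
    consistent-0 : consistent v zero ≡ true
    consistent-0 = cong (λ y → isLabel y zero) v-at-j+1
    consistent-j+1 : consistent v (suc j) ≡ true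
    consistent-j+1 = trans (cong (consistentAt v (suc j)) v-at-j+1) (dec-true (suc j ≟F suc j) refl)

  countSign-addCycle : ∀ c → countSign c v ≡ countSign c w
  countSign-addCycle c = begin
    countSign c v                                         ≡⟨ countSign-∑ v c ⟩
    signCount c v                                         ≡⟨ ∑-positions (λ i → 𝟙 (isSign c (lookup v i))) ⟩
    𝟙 (isSign c (lookup v (suc j))) + ∑ (λ i → 𝟙 (isSign c (lookup v (ρ i))))
      ≡⟨ cong₂ _+_ (cong (𝟙 ∘ isSign c) v-at-j+1) (∑-cong (sign-embed c)) ⟩
    signCount c w                                         ≡⟨ countSign-∑ w c ⟨
    countSign c w                                         ∎
    where open ≡-Reasoning

  twoCycles-addCycle : twoCycles v ≡ suc (twoCycles w)
  twoCycles-addCycle = begin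
    twoCycles v                           ≡⟨ twoCycles-∑ v ⟩
    pairCount v / 2                       ≡⟨ cong (_/ 2) (∑-positions (λ i → 𝟙 (isPair (lookup v i)))) ⟩
    suc (𝟙 (isPair (lookup v (suc j))) + ∑ (λ i → 𝟙 (isPair (lookup v (ρ i))))) / 2
      ≡⟨ cong (λ x → suc x / 2) (cong₂ _+_ (cong (𝟙 ∘ isPair) v-at-j+1) (∑-cong pair-embed)) ⟩
    suc (suc (pairCount w)) / 2           ≡⟨ m/n≡1+[m∸n]/n {m = suc (suc (pairCount w))} {n = 2} (s≤s (s≤s z≤n)) ⟩
    suc (pairCount w / 2)                 ≡⟨ cong suc (twoCycles-∑ w) ⟨
    suc (twoCycles w)                     ∎
    where open ≡-Reasoning

  private
    below : (Fin k → Fin k) → ℕ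
    below f = ∑ (λ i → 𝟙 (toℕ (f i) <ᵇ toℕ j))

  -- The inversions of v are (0, j+1), the (0, ρ i) with σ i < j, the
  -- (ρ i, j+1) with i < j, and the images of the inversions of σ.
  invCount-addCycle : invCount τ ≡ suc (below σ + (below (λ i → i) + invCount σ))
  invCount-addCycle = cong₂ _+_ row-0 (begin
    ∑ (λ a → row (suc a))                              ≡⟨ ∑-remove {i = j} (λ a → row (suc a)) ⟩
    row (suc j) + ∑ (λ i → row (ρ i))                  ≡⟨ cong₂ _+_ row-j+1 (∑-cong row-ρ) ⟩
    ∑ (λ i → 𝟙 (toℕ i <ᵇ toℕ j) + oldRow i)            ≡⟨ ∑-distrib-+ _ oldRow ⟩
    below (λ i → i) + invCount σ                        ∎)
    where
    open ≡-Reasoning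
    τ-at-j+1 : τ (suc j) ≡ zero
    τ-at-j+1 = cong (partnerOf (suc j)) v-at-j+1

    inversion : Fin (suc (suc k)) → Fin (suc (suc k)) → ℕ
    inversion a b = 𝟙 ((toℕ a <ᵇ toℕ b) ∧ (toℕ (τ b) <ᵇ toℕ (τ a)))

    row : Fin (suc (suc k)) → ℕ
    row a = ∑ (inversion a)

    oldRow : Fin k → ℕ
    oldRow a = ∑ (λ b → 𝟙 ((toℕ a <ᵇ toℕ b) ∧ (toℕ (σ b) <ᵇ toℕ (σ a))))

    inversion-ρ : ∀ a b → inversion (ρ a) (ρ b) ≡ 𝟙 ((toℕ a <ᵇ toℕ b) ∧ (toℕ (σ b) <ᵇ toℕ (σ a)))
    inversion-ρ a b =
      trans (cong₂ (λ x y → 𝟙 ((toℕ (punchIn j a) <ᵇ toℕ (punchIn j b)) ∧ (toℕ x <ᵇ toℕ y)))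
                   (π-embed b) (π-embed a))
            (cong₂ (λ x y → 𝟙 (x ∧ y)) (punchIn-<ᵇ j a b) (punchIn-<ᵇ j (σ b) (σ a)))

    row-0 : row zero ≡ suc (below σ)
    row-0 = trans (∑-remove {i = j} (λ b → inversion zero (suc b)))
      (cong₂ _+_ (cong (λ y → 𝟙 (toℕ y <ᵇ suc (toℕ j))) τ-at-j+1)
                 (∑-cong λ i → trans (cong (λ y → 𝟙 (toℕ y <ᵇ suc (toℕ j))) (π-embed i))
                                     (cong 𝟙 (punchIn-<ᵇ-self j (σ i)))))

    row-j+1 : row (suc j) ≡ 0
    row-j+1 = ∑-zero {suc (suc k)} λ b →
      trans (cong (λ y → 𝟙 ((toℕ (suc j) <ᵇ toℕ b) ∧ (toℕ (τ b) <ᵇ toℕ y))) τ-at-j+1)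
            (cong 𝟙 (∧-zeroʳ _))

    row-ρ : ∀ i → row (ρ i) ≡ 𝟙 (toℕ i <ᵇ toℕ j) + oldRow i
    row-ρ i = trans (∑-remove {i = j} (λ b → inversion (ρ i) (suc b)))
      (cong₂ _+_
        (trans (cong₂ (λ y z → 𝟙 ((toℕ (punchIn j i) <ᵇ toℕ j) ∧ (toℕ y <ᵇ toℕ z))) τ-at-j+1 (π-embed i))
               (trans (cong 𝟙 (∧-identityʳ _)) (cong 𝟙 (punchIn-<ᵇ-self j i))))
        (∑-cong (inversion-ρ i)))

  len-addCycle : wellFormed w ≡ true → len v ≡ suc (toℕ j) + len w
  len-addCycle wf = begin
    (inversions v + twoCycles v) / 2
      ≡⟨ cong₂ (λ x y → (x + y) / 2) (trans (inversions-∑ v) invCount-addCycle) twoCycles-addCycle ⟩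
    (suc (below σ + (below (λ i → i) + invCount σ)) + suc (twoCycles w)) / 2
      ≡⟨ cong₂ (λ x y → (suc (x + (y + invCount σ)) + suc (twoCycles w)) / 2) below-σ below-id ⟩
    (suc (toℕ j + (toℕ j + invCount σ)) + suc (twoCycles w)) / 2
      ≡⟨ cong (_/ 2) (regroup (toℕ j) (invCount σ) (twoCycles w)) ⟩
    (invCount σ + twoCycles w + suc (toℕ j) * 2) / 2
      ≡⟨ +-distrib-/-∣ʳ (invCount σ + twoCycles w) (n∣m*n (suc (toℕ j))) ⟩
    (invCount σ + twoCycles w) / 2 + suc (toℕ j) * 2 / 2
      ≡⟨ cong₂ (λ x y → (x + twoCycles w) / 2 + y) (sym (inversions-∑ w)) (m*n/n≡m (suc (toℕ j)) 2) ⟩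
    len w + suc (toℕ j)
      ≡⟨ +-comm (len w) (suc (toℕ j)) ⟩
    suc (toℕ j) + len w ∎
    where
    open ≡-Reasoning
    below-id : below (λ i → i) ≡ toℕ j
    below-id = ∑-below k (toℕ j) (toℕ≤pred[n] j)
    -- σ permutes the old positions, so it does not change the count
    below-σ : below σ ≡ toℕ j
    below-σ = trans (∑-involution σ (π-involution w wf) (λ i → 𝟙 (toℕ i <ᵇ toℕ j))) below-id
    regroup : ∀ t i c → suc (t + (t + i)) + suc c ≡ i + c + suc t * 2
    regroup = solve-∀

𝟙-split : ∀ P s x m → 𝟙 (P ∧ (suc s + x ≡ᵇ m)) ≡ 𝟙 (s <ᵇ m) * 𝟙 (P ∧ (x ≡ᵇ m ∸ suc s))
𝟙-split P zero    x zero    = cong 𝟙 (∧-zeroʳ P)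
𝟙-split P zero    x (suc m) = sym (+-identityʳ _)
𝟙-split P (suc s) x zero    = cong 𝟙 (∧-zeroʳ P)
𝟙-split P (suc s) x (suc m) = 𝟙-split P s x m

counted-addCycle : ∀ a b m (j : Fin (suc k)) (w : Vec (Label k) k) →
  counted a b m (addCycle j w) ≡ 𝟙 (toℕ j <ᵇ m) * counted a b (m ∸ suc (toℕ j)) w
counted-addCycle a b m j w with wellFormed w in wf
... | false = trans (counted-illFormed a b m (addCycle j w) (trans wellFormed-addCycle wf))
                    (sym (*-zeroʳ (𝟙 (toℕ j <ᵇ m))))
  where open AddCycle j w
... | true = trans
  (cong₂ (λ x y → 𝟙 (x ∧ y))
    (cong₂ _∧_ (trans wellFormed-addCycle wf)
               (cong₂ _≡ᵇ_ (cong (_+ b) (countSign-addCycle true)) (cong (_+ a) (countSign-addCycle false))))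
    (cong (_≡ᵇ m) (len-addCycle wf)))
  (𝟙-split (countSign true w + b ≡ᵇ countSign false w + a) (toℕ j) (len w) m)
  where open AddCycle j w

count-allLabels : (g : Label n → ℕ) →
  count g (allLabels n) ≡ ∑ (g ∘ inj₁) + (g (inj₂ true) + g (inj₂ false))
count-allLabels {n} g = begin
  count g (allLabels n)                                            ≡⟨ count-++ g (map inj₁ (allFin n)) _ ⟩
  count g (map inj₁ (allFin n)) + (g (inj₂ true) + (g (inj₂ false) + 0))
    ≡⟨ cong₂ _+_ (trans (count-map g inj₁ (allFin n)) (count-tabulate (g ∘ inj₁) (λ i → i)))
                 (cong (g (inj₂ true) +_) (+-identityʳ _)) ⟩
  ∑ (g ∘ inj₁) + (g (inj₂ true) + g (inj₂ false))                  ∎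
  where open ≡-Reasoning

count-allLabels-fixed : (g : Label (suc n) → ℕ) → (∀ x → x ≡ inj₁ zero → g x ≡ 0) →
  count g (allLabels (suc n)) ≡ count (g ∘ relabel suc) (allLabels n)
count-allLabels-fixed {n} g g0≡0 = begin
  count g (allLabels (suc n))
    ≡⟨ count-allLabels g ⟩
  (g (inj₁ zero) + ∑ (g ∘ inj₁ ∘ suc)) + signs
    ≡⟨ cong (λ t → (t + ∑ (g ∘ inj₁ ∘ suc)) + signs) (g0≡0 _ refl) ⟩
  ∑ (g ∘ inj₁ ∘ suc) + signs
    ≡⟨ count-allLabels (g ∘ relabel suc) ⟨
  count (g ∘ relabel suc) (allLabels n) ∎
  where
  open ≡-Reasoning
  signs = g (inj₂ true) + g (inj₂ false)

count-allLabels-cycle : (j : Fin (suc k)) (g : Label (suc (suc k)) → ℕ) →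
  (∀ x → (x ≡ inj₁ zero) ⊎ (x ≡ inj₁ (suc j)) → g x ≡ 0) →
  count g (allLabels (suc (suc k))) ≡ count (g ∘ relabel (cycleEmbedding j)) (allLabels k)
count-allLabels-cycle {k} j g g≡0 = begin
  count g (allLabels (suc (suc k)))
    ≡⟨ count-allLabels g ⟩
  (g (inj₁ zero) + ∑ (g ∘ inj₁ ∘ suc)) + signs
    ≡⟨ cong (_+ signs) (cong₂ _+_ (g≡0 _ (inj₁ refl)) (∑-remove {i = j} (g ∘ inj₁ ∘ suc))) ⟩
  (g (inj₁ (suc j)) + ∑ (g ∘ inj₁ ∘ cycleEmbedding j)) + signs
    ≡⟨ cong (λ t → (t + ∑ (g ∘ inj₁ ∘ cycleEmbedding j)) + signs) (g≡0 _ (inj₂ refl)) ⟩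
  ∑ (g ∘ inj₁ ∘ cycleEmbedding j) + signs
    ≡⟨ count-allLabels (g ∘ relabel (cycleEmbedding j)) ⟨
  count (g ∘ relabel (cycleEmbedding j)) (allLabels k) ∎
  where
  open ≡-Reasoning
  signs = g (inj₂ true) + g (inj₂ false)

count-allLabels-only0 : (g : Label (suc n) → ℕ) → (∀ x → isLabel x zero ≡ false → g x ≡ 0) →
  count g (allLabels (suc n)) ≡ g (inj₁ zero)
count-allLabels-only0 {n} g g≡0 = begin
  count g (allLabels (suc n))                               ≡⟨ count-allLabels g ⟩
  (g (inj₁ zero) + ∑ (g ∘ inj₁ ∘ suc)) + (g (inj₂ true) + g (inj₂ false))
    ≡⟨ cong₂ (λ x y → (g (inj₁ zero) + x) + y)
             (∑-zero (λ i → g≡0 (inj₁ (suc i)) refl))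
             (cong₂ _+_ (g≡0 (inj₂ true) refl) (g≡0 (inj₂ false) refl)) ⟩
  g (inj₁ zero) + 0 + 0                                     ≡⟨ trans (+-identityʳ _) (+-identityʳ _) ⟩
  g (inj₁ zero)                                             ∎
  where open ≡-Reasoning

fixedHead : ∀ a b m s →
  ∑Vec (allLabels (suc n)) n (λ w → counted a b m (inj₂ s ∷ w)) ≡
  ∑Vec (allLabels n) n (counted a b m ∘ addFixed s)
fixedHead {n} a b m s =
  ∑Vec-relabel (_≡ inj₁ zero) (relabel suc) (allLabels (suc n)) (allLabels n) count-allLabels-fixed n _
    λ w i wi≡0 → counted-illFormed a b m (inj₂ s ∷ w)
                   (illFormed-at (inj₂ s ∷ w) (suc i) (cong (consistentAt (inj₂ s ∷ w) (suc i)) wi≡0))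

cycleHead : ∀ a b m (j : Fin (suc k)) →
  ∑Vec (allLabels (suc (suc k))) (suc k) (λ w → counted a b m (inj₁ (suc j) ∷ w)) ≡
  𝟙 (toℕ j <ᵇ m) * signedCount k a b (m ∸ suc (toℕ j))
cycleHead {k} a b m j = begin
  ∑Vec L (suc k) (λ w → counted a b m (inj₁ (suc j) ∷ w))
    ≡⟨ ∑Vec-insertAt L k j _ ⟩
  count (λ x → ∑Vec L k (λ w′ → counted a b m (withAt w′ x))) L
    ≡⟨ count-allLabels-only0 _ (λ x x≢0 → ∑Vec-zero L k λ w′ → notBack w′ x x≢0) ⟩
  ∑Vec L k (λ w′ → counted a b m (withAt w′ (inj₁ zero)))
    ≡⟨ ∑Vec-relabel Bad (relabel ρ) L (allLabels k) (count-allLabels-cycle j) k _ bad ⟩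
  ∑Vec (allLabels k) k (counted a b m ∘ addCycle j)
    ≡⟨ ∑Vec-cong (allLabels k) k (counted-addCycle a b m j) ⟩
  ∑Vec (allLabels k) k (λ w → 𝟙 (toℕ j <ᵇ m) * counted a b (m ∸ suc (toℕ j)) w)
    ≡⟨ count-scale (𝟙 (toℕ j <ᵇ m)) _ (allVecs (allLabels k) k) ⟩
  𝟙 (toℕ j <ᵇ m) * signedCount k a b (m ∸ suc (toℕ j)) ∎
  where
  open ≡-Reasoning
  L = allLabels (suc (suc k))
  ρ = cycleEmbedding j

  withAt : Vec (Label (suc (suc k))) k → Label (suc (suc k)) → Vec (Label (suc (suc k))) (suc (suc k))
  withAt w′ x = inj₁ (suc j) ∷ insertAt w′ j x

  -- j+1 must point back to 0
  notBack : ∀ w′ x → isLabel x zero ≡ false → counted a b m (withAt w′ x) ≡ 0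
  notBack w′ x x≢0 = counted-illFormed a b m (withAt w′ x) (illFormed-at (withAt w′ x) zero
    (trans (cong (λ y → isLabel y zero) (insertAt-lookup w′ j x)) x≢0))

  -- no other position may point to 0 or to j+1
  Bad : Label (suc (suc k)) → Set
  Bad x = (x ≡ inj₁ zero) ⊎ (x ≡ inj₁ (suc j))

  bad : ∀ w′ i → Bad (lookup w′ i) → counted a b m (withAt w′ (inj₁ zero)) ≡ 0
  bad w′ i badLabel = counted-illFormed a b m v (illFormed-at v (ρ i) (inconsistent badLabel))
    where
    v = withAt w′ (inj₁ zero)
    v-at-ρi = insertAt-punchIn w′ j (inj₁ zero) i
    inconsistent : Bad (lookup w′ i) → consistent v (ρ i) ≡ false
    inconsistent (inj₁ wi≡0) =
      trans (cong (consistentAt v (ρ i)) (trans v-at-ρi wi≡0))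
            (dec-false (suc j ≟F ρ i) (punchInᵢ≢i j i ∘ sym ∘ suc-injective))
    inconsistent (inj₂ wi≡j+1) =
      trans (cong (consistentAt v (ρ i)) (trans v-at-ρi wi≡j+1))
            (trans (cong (λ y → not (does (suc j ≟F ρ i)) ∧ isLabel y (ρ i)) (insertAt-lookup w′ j (inj₁ zero)))
                   (∧-zeroʳ _))

cycleSum : ℕ → (ℕ → ℕ) → ℕ → ℕ
cycleSum M e m = ∑ {M} (λ j → 𝟙 (toℕ j <ᵇ m) * e (m ∸ suc (toℕ j)))

signedCount-recurrence : ∀ k a b m →
  signedCount (suc (suc k)) a b m ≡
  cycleSum (suc k) (signedCount k a b) m + (signedCount (suc k) a (suc b) m + signedCount (suc k) (suc a) b m)
signedCount-recurrence k a b m = begin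
  signedCount (suc (suc k)) a b m
    ≡⟨ ∑Vec-head L (suc k) (counted a b m) ⟩
  count head L
    ≡⟨ count-allLabels head ⟩
  (head (inj₁ zero) + ∑ (head ∘ inj₁ ∘ suc)) + (head (inj₂ true) + head (inj₂ false))
    ≡⟨ cong₂ _+_ (cong₂ _+_ selfPaired (∑-cong (cycleHead {k} a b m)))
                 (cong₂ _+_ (trans (fixedHead {suc k} a b m true)
                                   (∑Vec-cong (allLabels (suc k)) (suc k) (counted-addFixed-+ a b m)))
                            (trans (fixedHead {suc k} a b m false)
                                   (∑Vec-cong (allLabels (suc k)) (suc k) (counted-addFixed-− a b m)))) ⟩
  cycleSum (suc k) (signedCount k a b) m + (signedCount (suc k) a (suc b) m + signedCount (suc k) (suc a) b m) ∎
  where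
  open ≡-Reasoning
  L = allLabels (suc (suc k))
  head : Label (suc (suc k)) → ℕ
  head x = ∑Vec L (suc k) (λ w → counted a b m (x ∷ w))
  -- 0 cannot be its own partner
  selfPaired : head (inj₁ zero) ≡ 0
  selfPaired = ∑Vec-zero L (suc k) λ w →
    counted-illFormed a b m (inj₁ zero ∷ w) (illFormed-at (inj₁ zero ∷ w) zero refl)

signedCount-E : ∀ {n} a b m → n ≡ a + b → signedCount n (suc a) (suc b) m ≡ E a b m
signedCount-E {n} a b m n≡a+b = begin
  signedCount n (suc a) (suc b) m ≡⟨ signedCount-shift n a b m ⟩
  signedCount n a b m             ≡⟨ cong (λ n → signedCount n a b m) n≡a+b ⟩
  signedCount (a + b) a b m       ≡⟨ E-signedCount a b m ⟨
  E a b m                         ∎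
  where open ≡-Reasoning

E-recurrence : ∀ p q m → E (suc p) (suc q) m ≡ cycleSum (p + suc q) (E p q) m + (E p (suc q) m + E (suc p) q m)
E-recurrence p q m = begin
  E (suc p) (suc q) m
    ≡⟨ E-signedCount (suc p) (suc q) m ⟩
  signedCount (suc (p + suc q)) (suc p) (suc q) m
    ≡⟨ cong (λ n → signedCount (suc n) (suc p) (suc q) m) (+-suc p q) ⟩
  signedCount (suc (suc (p + q))) (suc p) (suc q) m
    ≡⟨ signedCount-recurrence (p + q) (suc p) (suc q) m ⟩
  cycleSum (suc (p + q)) (signedCount (p + q) (suc p) (suc q)) m
    + (signedCount (suc (p + q)) (suc p) (suc (suc q)) m + signedCount (suc (p + q)) (suc (suc p)) (suc q) m)
    ≡⟨ cong₂ _+_ (∑-cong {suc (p + q)} λ j → cong (𝟙 (toℕ j <ᵇ m) *_) (signedCount-E p q (m ∸ suc (toℕ j)) refl))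
                 (cong₂ _+_ (signedCount-E p (suc q) m (sym (+-suc p q))) (signedCount-E (suc p) q m refl)) ⟩
  cycleSum (suc (p + q)) (E p q) m + (E p (suc q) m + E (suc p) q m)
    ≡⟨ cong (λ M → cycleSum M (E p q) m + (E p (suc q) m + E (suc p) q m)) (+-suc p q) ⟨
  cycleSum (p + suc q) (E p q) m + (E p (suc q) m + E (suc p) q m) ∎
  where open ≡-Reasoning

-- Multiplying by [M+1]_t − 1 = t + ⋯ + t^M sums the shifts of e by 1, …, M:
-- the coefficient of t^m is ∑_{1 ≤ i ≤ min m M} e(m − i) (no constant term).
qint-convolution : ∀ M (e : Poly) m → ((qint (suc M) ⊖ onePoly) ⊛ e) m ≡ cycleSum M e m
qint-convolution M e m =
  trans (count-applyUpTo (λ i → (qint (suc M) ⊖ onePoly) i * e (m ∸ i)) suc m)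
        (∑-truncate-swap M m (λ t → e (m ∸ suc t)))

theorem7p6 : ∀ (p q : ℕ) → (m : ℕ) →
    E (suc p) (suc q) m ≡
      (E p (suc q) ⊕ E (suc p) q ⊕ ((qint (suc p + suc q) ⊖ onePoly) ⊛ E p q)) m
theorem7p6 p q m = begin
  E (suc p) (suc q) m
    ≡⟨ E-recurrence p q m ⟩
  cycleSum (p + suc q) (E p q) m + (E p (suc q) m + E (suc p) q m)
    ≡⟨ +-comm (cycleSum (p + suc q) (E p q) m) _ ⟩
  E p (suc q) m + E (suc p) q m + cycleSum (p + suc q) (E p q) m
    ≡⟨ cong (E p (suc q) m + E (suc p) q m +_) (qint-convolution (p + suc q) (E p q) m) ⟨
  (E p (suc q) ⊕ E (suc p) q ⊕ ((qint (suc p + suc q) ⊖ onePoly) ⊛ E p q)) m ∎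
  where open ≡-Reasoning
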